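{- Let $D$ and $E$ be dominated dcpos. The following are equivalent: (1) $D\cong E$; (2) $\Gamma(D)\cong\Gamma(E)$; (3) $\mathsf{Irr}(D)\cong\mathsf{Irr}(E)$ (all isomorphisms being order isomorphisms).
   Context: For a dcpo $D$, $\Gamma(D)$ denotes the complete lattice of Scott-closed subsets of $D$ ordered by inclusion. A subset of $D$ is irreducible if it is nonempty and whenever it is contained in a union $B\cup C$ of two Scott-closed sets it is contained in $B$ or in $C$; "closed irreducible" means Scott-closed and irreducible. $\mathsf{Irr}(D)$ denotes the set of closed irreducible subsets of $D$ ordered by inclusion. For $A',A\in\mathsf{Irr}(D)$ write $A'\triangleleft A$ if there is $x\in A$ with $A'\subseteq{\downarrow}x$, and $\nabla A=\{A'\in\mathsf{Irr}(D)\mid A'\triangleleft A\}$. A dcpo $D$ is dominated if for every $A\in\mathsf{Irr}(D)$ the collection $\nabla A$ is Scott-closed in the poset $\mathsf{Irr}(D)$. -}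

module Defs where

open import Level using (Level; _⊔_; suc)
open import Data.Product using (Σ; ∃; _×_; _,_; proj₁)
open import Data.Sum using (_⊎_)
open import Relation.Unary using (Pred; _∈_; _⊆_; _∪_)
open import Relation.Binary.Bundles using (Poset)

module _ {a r : Level} {X : Set a} (_≤_ : X → X → Set r) where

  Directed : ∀ {s} → Pred X s → Set (a ⊔ r ⊔ s)
  Directed S = (∃ λ x → x ∈ S)
             × (∀ x y → x ∈ S → y ∈ S → ∃ λ z → z ∈ S × (x ≤ z) × (y ≤ z))

  IsSup : ∀ {s} → Pred X s → X → Set (a ⊔ r ⊔ s)
  IsSup S u = (∀ x → x ∈ S → x ≤ u)
            × (∀ v → (∀ x → x ∈ S → x ≤ v) → u ≤ v)

  ScottClosed : ∀ {s} (t : Level) → Pred X s → Set (a ⊔ r ⊔ s ⊔ suc t)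
  ScottClosed t A = (∀ x y → x ∈ A → y ≤ x → y ∈ A)
                  × (∀ (S : Pred X t) u → Directed S → S ⊆ A → IsSup S u → u ∈ A)

OrderIso : ∀ {a r b q} {X : Set a} {Y : Set b}
           (_≤X_ : X → X → Set r) (_≤Y_ : Y → Y → Set q) → Set (a ⊔ r ⊔ b ⊔ q)
OrderIso {X = X} {Y} _≤X_ _≤Y_ =
  Σ (X → Y) λ f → Σ (Y → X) λ g →
      (∀ x x' → x ≤X x' → f x ≤Y f x')
    × (∀ x x' → f x ≤Y f x' → x ≤X x')
    × (∀ y → (f (g y) ≤Y y) × (y ≤Y f (g y)))
    × (∀ x → (g (f x) ≤X x) × (x ≤X g (f x)))

record Dcpo (ℓ : Level) : Set (suc ℓ) where
  field
    poset : Poset ℓ ℓ ℓ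
  open Poset poset public using (Carrier; _≤_; _≈_)
  field
    directedComplete : ∀ (S : Pred Carrier ℓ) → Directed _≤_ S → ∃ λ u → IsSup _≤_ S u

module _ {ℓ : Level} (D : Dcpo ℓ) where
  open Dcpo D

  IsScottClosed : Pred Carrier ℓ → Set (suc ℓ)
  IsScottClosed = ScottClosed _≤_ ℓ

  Γ : Set (suc ℓ)
  Γ = Σ (Pred Carrier ℓ) IsScottClosed

  _⊑Γ_ : Γ → Γ → Set ℓ
  A ⊑Γ B = proj₁ A ⊆ proj₁ B

  Irreducible : Pred Carrier ℓ → Set (suc ℓ)
  Irreducible A = (∃ λ x → x ∈ A)
                × (∀ B C → IsScottClosed B → IsScottClosed C →
                     A ⊆ (B ∪ C) → (A ⊆ B) ⊎ (A ⊆ C))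

  Irr : Set (suc ℓ)
  Irr = Σ (Pred Carrier ℓ) λ A → IsScottClosed A × Irreducible A

  _⊑Irr_ : Irr → Irr → Set ℓ
  A ⊑Irr B = proj₁ A ⊆ proj₁ B

  ↓_ : Carrier → Pred Carrier ℓ
  ↓ x = λ y → y ≤ x

  _◁_ : Irr → Irr → Set ℓ
  A' ◁ A = ∃ λ x → x ∈ proj₁ A × (proj₁ A' ⊆ ↓ x)

  ∇ : Irr → Pred Irr ℓ
  ∇ A = λ A' → A' ◁ A

  Dominated : Set (suc (suc ℓ))
  Dominated = ∀ A → ScottClosed _⊑Irr_ (suc ℓ) (∇ A)

-- (1)⇒(2): an order isomorphism pulls Scott-closed sets back to Scott-closed sets.
-- (2)⇒(3): in Γ(D) the closed irreducible sets are the elements that are not below ∅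
-- and are prime for the binary join ∪, an order-theoretic property.
-- (3)⇒(1): D embeds into Irr(D) by x ↦ ↓x, and for dominated D its image is
-- characterised order-theoretically: A is principal iff A belongs to every
-- Scott-closed irreducible family in Irr(D) with supremum A. For A = ↓x the points y
-- with ↓y in such a family form a closed irreducible set containing x; conversely ∇A
-- is such a family by domination, and A ∈ ∇A says A ⊆ ↓x for some x ∈ A.
-- In (2)⇒(3) and (3)⇒(1) the given isomorphism restricts to the embedded copies.

module Submission where

open import Defs
open import Level using (_⊔_; suc; Lift; lift; lower)
open import Data.Product using (_×_; ∃; _,_; proj₁; proj₂)
open import Data.Sum using (_⊎_; inj₁; inj₂)
open import Data.Empty using (⊥; ⊥-elim)
open import Function using (_∘_; _on_; case_of_)
open import Relation.Nullary using (yes; no)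
open import Relation.Nullary.Decidable using (True; toWitness; fromWitness; map′)
open import Relation.Unary using (Pred; _∈_; _⊆_; _∪_; _≐_)
open import Relation.Unary.Relation.Binary.Subset using (⊆-isPreorder)
open import Relation.Binary.Core using (Rel)
open import Relation.Binary.Structures using (IsPreorder)
import Relation.Binary.Construct.On as On
open import Relation.Binary.Bundles using (Poset)
open import Relation.Binary.Definitions using (Transitive)
open import Relation.Binary.Construct.Interior.Symmetric using (SymInterior; _,_; lhs≤rhs; rhs≤lhs)
open import Axiom.ExcludedMiddle using (ExcludedMiddle)

em-lower : ∀ {a} b → ExcludedMiddle (a ⊔ b) → ExcludedMiddle a
em-lower b em {P} = map′ lower lift (em {Lift b P})

-- Excluded middle lets a proposition of any universe be replaced by an
-- equivalent one in a lower universe.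
module _ {b} (em : ExcludedMiddle b) where

  Resized : ∀ a → Set b → Set a
  Resized a P = Lift a (True (em {P}))

  resize : ∀ {a P} → P → Resized a P
  resize p = lift (fromWitness p)

  unresize : ∀ {a P} → Resized a P → P
  unresize r = toWitness (lower r)

module _ {a r} {X : Set a} (_≤_ : Rel X r) where

  IsLower : ∀ {p} → Pred X p → Set (a ⊔ r ⊔ p)
  IsLower P = ∀ x y → x ∈ P → y ≤ x → y ∈ P

  Cofinal : ∀ {s t} → Pred X s → Pred X t → Set (a ⊔ r ⊔ s ⊔ t)
  Cofinal T S = ∀ {x} → x ∈ S → ∃ λ y → y ∈ T × x ≤ y

  IsIrreducible : ∀ {s} → Pred X s → Set (suc (a ⊔ r ⊔ s))
  IsIrreducible {s} L =
      (∃ λ x → x ∈ L)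
    × (∀ (M N : Pred X s) → ScottClosed _≤_ (a ⊔ r) M → ScottClosed _≤_ (a ⊔ r) N →
         L ⊆ M ∪ N → L ⊆ M ⊎ L ⊆ N)

  -- For a dominated D, the inaccessible elements of Irr(D) are exactly the principal ideals.
  Inaccessible : ∀ s → X → Set (suc (a ⊔ r ⊔ s))
  Inaccessible s x =
    ∀ (L : Pred X s) → ScottClosed _≤_ (a ⊔ r) L → IsIrreducible L → IsSup _≤_ L x → x ∈ L

  module _ (≤-trans : Transitive _≤_) where

    cofinal-sup-∈ : ∀ {t} {S T B : Pred X t} {u} → ScottClosed _≤_ t B →
                    Directed _≤_ S → IsSup _≤_ S u → T ⊆ S → Cofinal T S → T ⊆ B → u ∈ B
    cofinal-sup-∈ {S = S} {T} {u = u} (_ , sup∈B) ((x₀ , x₀∈S) , upper) (ub , lub) T⊆S cofinal T⊆B =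
      sup∈B T u (directedT , upperT) T⊆B (ubT , lubT)
      where
      directedT : ∃ λ x → x ∈ T
      directedT = proj₁ (cofinal x₀∈S) , proj₁ (proj₂ (cofinal x₀∈S))
      upperT : ∀ x y → x ∈ T → y ∈ T → ∃ λ z → z ∈ T × x ≤ z × y ≤ z
      upperT x y x∈T y∈T with upper x y (T⊆S x∈T) (T⊆S y∈T)
      ... | z , z∈S , x≤z , y≤z with cofinal z∈S
      ...   | w , w∈T , z≤w = w , w∈T , ≤-trans x≤z z≤w , ≤-trans y≤z z≤w
      ubT : ∀ x → x ∈ T → x ≤ u
      ubT x x∈T = ub x (T⊆S x∈T)
      lubT : ∀ v → (∀ x → x ∈ T → x ≤ v) → u ≤ v
      lubT v T≤v = lub v λ x x∈S → case cofinal x∈S of λ where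
        (y , y∈T , x≤y) → ≤-trans x≤y (T≤v y y∈T)

    ∪-scottClosed : ExcludedMiddle (a ⊔ r) → {B C : Pred X (a ⊔ r)} →
                    ScottClosed _≤_ (a ⊔ r) B → ScottClosed _≤_ (a ⊔ r) C →
                    ScottClosed _≤_ (a ⊔ r) (B ∪ C)
    ∪-scottClosed em {B} {C} scB@(lowB , _) scC@(lowC , _) = lower∪ , sup∈∪
      where
      lower∪ : IsLower (B ∪ C)
      lower∪ x y (inj₁ x∈B) y≤x = inj₁ (lowB x y x∈B y≤x)
      lower∪ x y (inj₂ x∈C) y≤x = inj₂ (lowC x y x∈C y≤x)
      sup∈∪ : ∀ (S : Pred X (a ⊔ r)) u → Directed _≤_ S → S ⊆ B ∪ C → IsSup _≤_ S u → u ∈ B ∪ C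
      sup∈∪ S u dirS@(_ , upper) S⊆B∪C supS
        with em {∃ λ t → t ∈ S × (∀ {y} → y ∈ S → t ≤ y → y ∈ C)}
      ... | yes (t , t∈S , above-t⊆C) =
        inj₂ (cofinal-sup-∈ scC dirS supS proj₁ cofinal (λ (y∈S , t≤y) → above-t⊆C y∈S t≤y))
        where
        cofinal : Cofinal (λ y → y ∈ S × t ≤ y) S
        cofinal {x} x∈S with upper x t x∈S t∈S
        ... | z , z∈S , x≤z , t≤z = z , (z∈S , t≤z) , x≤z
      ... | no no-tail-in-C = inj₁ (cofinal-sup-∈ scB dirS supS proj₁ cofinal proj₂)
        where
        cofinal : Cofinal (λ y → y ∈ S × y ∈ B) S
        cofinal {x} x∈S with em {∃ λ y → y ∈ S × x ≤ y × y ∈ B}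
        ... | yes (y , y∈S , x≤y , y∈B) = y , (y∈S , y∈B) , x≤y
        ... | no nothing-above = ⊥-elim (no-tail-in-C (x , x∈S , above-x⊆C))
          where
          above-x⊆C : ∀ {y} → y ∈ S → x ≤ y → y ∈ C
          above-x⊆C {y} y∈S x≤y with S⊆B∪C y∈S
          ... | inj₁ y∈B = ⊥-elim (nothing-above (y , y∈S , x≤y , y∈B))
          ... | inj₂ y∈C = y∈C

  directed-⊆-∪ : ∀ {t p} → ExcludedMiddle (a ⊔ t ⊔ p) → {S : Pred X t} {P Q : Pred X p} →
                 Directed _≤_ S → IsLower P → IsLower Q → S ⊆ P ∪ Q → S ⊆ P ⊎ S ⊆ Q
  directed-⊆-∪ {t} {p} em {S} {P} {Q} (_ , upper) lowP lowQ S⊆P∪Q with em {S ⊆ P}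
  ... | yes S⊆P = inj₁ S⊆P
  ... | no S⊈P = inj₂ S⊆Q
    where
    S⊆Q : S ⊆ Q
    S⊆Q {x} x∈S with em-lower (a ⊔ t) em {x ∈ Q}
    ... | yes x∈Q = x∈Q
    ... | no x∉Q = ⊥-elim (S⊈P S⊆P)
      where
      S⊆P : S ⊆ P
      S⊆P {y} y∈S with upper x y x∈S y∈S
      ... | z , z∈S , x≤z , y≤z with S⊆P∪Q z∈S
      ...   | inj₁ z∈P = lowP z y z∈P y≤z
      ...   | inj₂ z∈Q = ⊥-elim (x∉Q (lowQ z x z∈Q x≤z))

record IsOrderEmbedding {a b r q} {X : Set a} {Y : Set b}
       (_≤X_ : Rel X r) (_≤Y_ : Rel Y q) (e : X → Y) : Set (a ⊔ r ⊔ q) where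
  field
    mono    : ∀ {x y} → x ≤X y → e x ≤Y e y
    reflect : ∀ {x y} → e x ≤Y e y → x ≤X y

module _ {a b e r q} {X : Set a} {Y : Set b} {_≤X_ : Rel X r} {_≈Y_ : Rel Y e} {_≤Y_ : Rel Y q}
         (≤Y-isPreorder : IsPreorder _≈Y_ _≤Y_) where

  open IsPreorder ≤Y-isPreorder using () renaming (refl to ≤Y-refl; trans to ≤Y-trans)

  OrderIso-sym : OrderIso _≤X_ _≤Y_ → OrderIso _≤Y_ _≤X_
  OrderIso-sym (f , g , f-mono , f-reflect , fg , gf) = g , f , g-mono , g-reflect , gf , fg
    where
    g-mono : ∀ y y' → y ≤Y y' → g y ≤X g y'
    g-mono y y' y≤y' =
      f-reflect (g y) (g y') (≤Y-trans (proj₁ (fg y)) (≤Y-trans y≤y' (proj₂ (fg y'))))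
    g-reflect : ∀ y y' → g y ≤X g y' → y ≤Y y'
    g-reflect y y' gy≤gy' =
      ≤Y-trans (proj₂ (fg y)) (≤Y-trans (f-mono (g y) (g y') gy≤gy') (proj₁ (fg y')))

  -- The hypothesis says that f u is the supremum of f[S]. The lower set generated
  -- by f[S] is lifted to the level at which P is assumed Scott-closed.
  continuous-preimage-scottClosed :
    ∀ {s t} t' {f : X → Y} → (∀ {x x'} → x ≤X x' → f x ≤Y f x') →
    (∀ (S : Pred X t) u v → Directed _≤X_ S → IsSup _≤X_ S u → (∀ x → x ∈ S → f x ≤Y v) → f u ≤Y v) →
    {P : Pred Y s} → ScottClosed _≤Y_ (a ⊔ q ⊔ t ⊔ t') P → ScottClosed _≤X_ t (P ∘ f)
  continuous-preimage-scottClosed {t = t} t' {f} f-mono continuous {P} (lowP , sup∈P) = lowPf , sup∈Pf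
    where
    lowPf : IsLower _≤X_ (P ∘ f)
    lowPf x y fx∈P y≤x = lowP (f x) (f y) fx∈P (f-mono y≤x)
    sup∈Pf : ∀ (S : Pred X t) u → Directed _≤X_ S → S ⊆ P ∘ f → IsSup _≤X_ S u → f u ∈ P
    sup∈Pf S u dirS@((x₀ , x₀∈S) , upper) fS⊆P supS@(ub , _) =
      sup∈P ↓fS (f u) (nonempty , upper↓fS) ↓fS⊆P (ub↓fS , lub↓fS)
      where
      ↓fS : Pred Y (a ⊔ q ⊔ t ⊔ t')
      ↓fS y = Lift t' (∃ λ x → x ∈ S × y ≤Y f x)
      nonempty : ∃ λ y → y ∈ ↓fS
      nonempty = f x₀ , lift (x₀ , x₀∈S , ≤Y-refl)
      upper↓fS : ∀ y y' → y ∈ ↓fS → y' ∈ ↓fS → ∃ λ z → z ∈ ↓fS × y ≤Y z × y' ≤Y z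
      upper↓fS y y' (lift (x , x∈S , y≤fx)) (lift (x' , x'∈S , y'≤fx'))
        with upper x x' x∈S x'∈S
      ... | z , z∈S , x≤z , x'≤z =
        f z , lift (z , z∈S , ≤Y-refl) , ≤Y-trans y≤fx (f-mono x≤z) , ≤Y-trans y'≤fx' (f-mono x'≤z)
      ↓fS⊆P : ↓fS ⊆ P
      ↓fS⊆P (lift (x , x∈S , y≤fx)) = lowP (f x) _ (fS⊆P x∈S) y≤fx
      ub↓fS : ∀ y → y ∈ ↓fS → y ≤Y f u
      ub↓fS y (lift (x , x∈S , y≤fx)) = ≤Y-trans y≤fx (f-mono (ub x x∈S))
      lub↓fS : ∀ v → (∀ y → y ∈ ↓fS → y ≤Y v) → f u ≤Y v
      lub↓fS v ↓fS≤v = continuous S u v dirS supS λ x x∈S → ↓fS≤v (f x) (lift (x , x∈S , ≤Y-refl))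

module _ {a e r} {X Y : Set a} {_≤X_ : Rel X r} {_≈Y_ : Rel Y e} {_≤Y_ : Rel Y r}
         (≤Y-isPreorder : IsPreorder _≈Y_ _≤Y_) where

  open IsPreorder ≤Y-isPreorder using () renaming (trans to ≤Y-trans)

  OrderIso-preimage-scottClosed :
    (iso : OrderIso _≤X_ _≤Y_) → ∀ {s} {P : Pred Y s} →
    ScottClosed _≤Y_ (a ⊔ r) P → ScottClosed _≤X_ (a ⊔ r) (P ∘ proj₁ iso)
  OrderIso-preimage-scottClosed (f , g , f-mono , f-reflect , fg , _) =
    continuous-preimage-scottClosed ≤Y-isPreorder (a ⊔ r) (f-mono _ _) continuous
    where
    continuous : ∀ (S : Pred X (a ⊔ r)) u v → Directed _≤X_ S → IsSup _≤X_ S u →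
                 (∀ x → x ∈ S → f x ≤Y v) → f u ≤Y v
    continuous S u v _ (_ , lub) fS≤v =
      ≤Y-trans (f-mono u (g v) (lub (g v) λ x x∈S →
                  f-reflect x (g v) (≤Y-trans (fS≤v x x∈S) (proj₂ (fg v)))))
               (proj₁ (fg v))

module _ {a e e' r} {X Y : Set a} {_≈X_ : Rel X e} {_≤X_ : Rel X r} {_≈Y_ : Rel Y e'} {_≤Y_ : Rel Y r}
         (≤X-isPreorder : IsPreorder _≈X_ _≤X_) (≤Y-isPreorder : IsPreorder _≈Y_ _≤Y_) where

  open IsPreorder ≤Y-isPreorder using () renaming (trans to ≤Y-trans)

  OrderIso-inaccessible :
    (iso : OrderIso _≤X_ _≤Y_) → ∀ {s} {x} → Inaccessible _≤X_ s x → Inaccessible _≤Y_ s (proj₁ iso x)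
  OrderIso-inaccessible iso@(f , g , f-mono , f-reflect , fg , gf) {x = x} x-inacc
    L scL@(lowL , _) ((y₀ , y₀∈L) , splitL) (ub , lub) =
    x-inacc (L ∘ f) (OrderIso-preimage-scottClosed ≤Y-isPreorder iso scL) (nonempty , split) (ubX , lubX)
    where
    g⁻¹-scottClosed : ∀ {P : Pred X _} → ScottClosed _≤X_ (a ⊔ r) P → ScottClosed _≤Y_ (a ⊔ r) (P ∘ g)
    g⁻¹-scottClosed = OrderIso-preimage-scottClosed ≤X-isPreorder (OrderIso-sym ≤Y-isPreorder iso)
    g∈ : ∀ {y} → y ∈ L → g y ∈ L ∘ f
    g∈ {y} y∈L = lowL y (f (g y)) y∈L (proj₁ (fg y))
    nonempty : ∃ λ x' → x' ∈ L ∘ f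
    nonempty = g y₀ , g∈ y₀∈L
    split : ∀ M N → ScottClosed _≤X_ (a ⊔ r) M → ScottClosed _≤X_ (a ⊔ r) N →
            L ∘ f ⊆ M ∪ N → L ∘ f ⊆ M ⊎ L ∘ f ⊆ N
    split M N scM scN Lf⊆M∪N
      with splitL (M ∘ g) (N ∘ g) (g⁻¹-scottClosed scM) (g⁻¹-scottClosed scN) (Lf⊆M∪N ∘ g∈)
    ... | inj₁ L⊆Mg = inj₁ λ {x'} fx'∈L → proj₁ scM (g (f x')) x' (L⊆Mg fx'∈L) (proj₂ (gf x'))
    ... | inj₂ L⊆Ng = inj₂ λ {x'} fx'∈L → proj₁ scN (g (f x')) x' (L⊆Ng fx'∈L) (proj₂ (gf x'))
    ubX : ∀ x' → x' ∈ L ∘ f → x' ≤X x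
    ubX x' fx'∈L = f-reflect x' x (ub (f x') fx'∈L)
    lubX : ∀ v → (∀ x' → x' ∈ L ∘ f → x' ≤X v) → x ≤X v
    lubX v Lf≤v = f-reflect x v (lub (f v) λ y y∈L →
      ≤Y-trans (proj₂ (fg y)) (f-mono (g y) v (Lf≤v (g y) (g∈ y∈L))))

module _ {a a' b b' e e' r r' q q'} {X : Set a} {X' : Set a'} {Y : Set b} {Y' : Set b'}
         {_≤X_ : Rel X r} {_≈X'_ : Rel X' e} {_≤X'_ : Rel X' r'}
         {_≤Y_ : Rel Y q} {_≈Y'_ : Rel Y' e'} {_≤Y'_ : Rel Y' q'}
         (≤X'-isPreorder : IsPreorder _≈X'_ _≤X'_) (≤Y'-isPreorder : IsPreorder _≈Y'_ _≤Y'_)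
         {eX : X → X'} {eY : Y → Y'}
         (eX-emb : IsOrderEmbedding _≤X_ _≤X'_ eX) (eY-emb : IsOrderEmbedding _≤Y_ _≤Y'_ eY) where

  private
    module EX = IsOrderEmbedding eX-emb
    module EY = IsOrderEmbedding eY-emb
  open IsPreorder ≤X'-isPreorder using () renaming (trans to ≤X'-trans)
  open IsPreorder ≤Y'-isPreorder using () renaming (trans to ≤Y'-trans)

  OrderIso-restrict :
    (iso : OrderIso _≤X'_ _≤Y'_) →
    (∀ x → ∃ λ y → SymInterior _≤Y'_ (proj₁ iso (eX x)) (eY y)) →
    (∀ y → ∃ λ x → SymInterior _≤X'_ (proj₁ (proj₂ iso) (eY y)) (eX x)) →
    OrderIso _≤X_ _≤Y_
  OrderIso-restrict iso@(f , g , f-mono , f-reflect , fg , gf) φ-spec ψ-spec =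
    φ , ψ , φ-mono , φ-reflect , φψ , ψφ
    where
    φ : X → Y
    φ x = proj₁ (φ-spec x)
    ψ : Y → X
    ψ y = proj₁ (ψ-spec y)
    f≃φ : ∀ x → SymInterior _≤Y'_ (f (eX x)) (eY (φ x))
    f≃φ x = proj₂ (φ-spec x)
    g≃ψ : ∀ y → SymInterior _≤X'_ (g (eY y)) (eX (ψ y))
    g≃ψ y = proj₂ (ψ-spec y)
    g-mono : ∀ y y' → y ≤Y' y' → g y ≤X' g y'
    g-mono = proj₁ (proj₂ (proj₂ (OrderIso-sym ≤Y'-isPreorder iso)))
    φ-mono : ∀ x x' → x ≤X x' → φ x ≤Y φ x'
    φ-mono x x' x≤x' = EY.reflect
      (≤Y'-trans (rhs≤lhs (f≃φ x)) (≤Y'-trans (f-mono _ _ (EX.mono x≤x')) (lhs≤rhs (f≃φ x'))))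
    φ-reflect : ∀ x x' → φ x ≤Y φ x' → x ≤X x'
    φ-reflect x x' φx≤φx' = EX.reflect (f-reflect _ _
      (≤Y'-trans (lhs≤rhs (f≃φ x)) (≤Y'-trans (EY.mono φx≤φx') (rhs≤lhs (f≃φ x')))))
    φψ : ∀ y → (φ (ψ y) ≤Y y) × (y ≤Y φ (ψ y))
    φψ y = EY.reflect (≤Y'-trans (rhs≤lhs (f≃φ (ψ y)))
                        (≤Y'-trans (f-mono _ _ (rhs≤lhs (g≃ψ y))) (proj₁ (fg (eY y)))))
         , EY.reflect (≤Y'-trans (proj₂ (fg (eY y)))
                        (≤Y'-trans (f-mono _ _ (lhs≤rhs (g≃ψ y))) (lhs≤rhs (f≃φ (ψ y)))))
    ψφ : ∀ x → (ψ (φ x) ≤X x) × (x ≤X ψ (φ x))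
    ψφ x = EX.reflect (≤X'-trans (rhs≤lhs (g≃ψ (φ x)))
                        (≤X'-trans (g-mono _ _ (rhs≤lhs (f≃φ x))) (proj₁ (gf (eX x)))))
         , EX.reflect (≤X'-trans (proj₂ (gf (eX x)))
                        (≤X'-trans (g-mono _ _ (lhs≤rhs (f≃φ x))) (lhs≤rhs (g≃ψ (φ x)))))

module _ {ℓ} (D : Dcpo ℓ) where
  open Dcpo D using (Carrier; _≤_; poset)
  open Poset poset using () renaming (refl to ≤-refl; trans to ≤-trans)

  private
    _⊑_ : Irr D → Irr D → Set ℓ
    _⊑_ = _⊑Irr_ D

  ⊑Irr-isPreorder : IsPreorder (_≐_ on proj₁) _⊑_
  ⊑Irr-isPreorder = On.isPreorder proj₁ ⊆-isPreorder

  ↓-scottClosed : ∀ x → IsScottClosed D (↓_ D x)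
  ↓-scottClosed x = (λ y z z≤y y≤x → ≤-trans y≤x z≤y) , λ S u _ S⊆↓x (_ , lub) → lub x λ _ → S⊆↓x

  ↓-irreducible : ∀ x → Irreducible D (↓_ D x)
  ↓-irreducible x = (x , Poset.refl poset) , split
    where
    split : ∀ B C → IsScottClosed D B → IsScottClosed D C → ↓_ D x ⊆ B ∪ C → ↓_ D x ⊆ B ⊎ ↓_ D x ⊆ C
    split B C (lowB , _) (lowC , _) ↓x⊆B∪C with ↓x⊆B∪C ≤-refl
    ... | inj₁ x∈B = inj₁ λ {y} y≤x → lowB x y x∈B y≤x
    ... | inj₂ x∈C = inj₂ λ {y} y≤x → lowC x y x∈C y≤x

  principal : Carrier → Irr D
  principal x = ↓_ D x , ↓-scottClosed x , ↓-irreducible x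

  principal-embedding : IsOrderEmbedding _≤_ _⊑_ principal
  principal-embedding = record
    { mono    = λ x≤x' y≤x → ≤-trans y≤x x≤x'
    ; reflect = λ ↓x⊆↓x' → ↓x⊆↓x' ≤-refl
    }

  principal⊑ : (A : Irr D) → ∀ {x} → x ∈ proj₁ A → principal x ⊑ A
  principal⊑ (_ , (lowA , _) , _) {x} x∈A y≤x = lowA x _ x∈A y≤x

  principal-preimage-scottClosed : ∀ {M : Pred (Irr D) ℓ} →
    ScottClosed _⊑_ (suc ℓ) M → IsScottClosed D (M ∘ principal)
  principal-preimage-scottClosed =
    continuous-preimage-scottClosed ⊑Irr-isPreorder (suc ℓ) (IsOrderEmbedding.mono principal-embedding) continuous
    where
    continuous : ∀ (S : Pred Carrier ℓ) u v → Directed _≤_ S → IsSup _≤_ S u →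
                 (∀ x → x ∈ S → principal x ⊑ v) → principal u ⊑ v
    continuous S u (V , (lowV , sup∈V) , _) dirS supS S⊑v y≤u =
      lowV u _ (sup∈V S u dirS (λ {x} x∈S → S⊑v x x∈S ≤-refl) supS) y≤u

  inaccessible⇒principal : Dominated D → ∀ A → Inaccessible _⊑_ ℓ A →
                           ∃ λ x → SymInterior _⊑_ A (principal x)
  inaccessible⇒principal dominated A@(_ , _ , (x₀ , x₀∈A) , splitA) A-inacc =
    principal-above (A-inacc (∇ D A) (dominated A) (nonempty , split) (ub , lub))
    where
    principal-above : A ∈ ∇ D A → ∃ λ x → SymInterior _⊑_ A (principal x)
    principal-above (x , x∈A , A⊆↓x) = x , A⊆↓x , principal⊑ A x∈A
    principal◁A : ∀ {x} → x ∈ proj₁ A → _◁_ D (principal x) A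
    principal◁A {x} x∈A = x , x∈A , λ y≤x → y≤x
    nonempty : ∃ λ A' → A' ∈ ∇ D A
    nonempty = principal x₀ , principal◁A x₀∈A
    split : ∀ M N → ScottClosed _⊑_ (suc ℓ) M → ScottClosed _⊑_ (suc ℓ) N →
            ∇ D A ⊆ M ∪ N → ∇ D A ⊆ M ⊎ ∇ D A ⊆ N
    split M N scM scN ∇A⊆M∪N
      with splitA (M ∘ principal) (N ∘ principal)
                  (principal-preimage-scottClosed scM) (principal-preimage-scottClosed scN)
                  (∇A⊆M∪N ∘ principal◁A)
    ... | inj₁ A⊆M = inj₁ λ { {A'} (x , x∈A , A'⊆↓x) → proj₁ scM (principal x) A' (A⊆M x∈A) A'⊆↓x }
    ... | inj₂ A⊆N = inj₂ λ { {A'} (x , x∈A , A'⊆↓x) → proj₁ scN (principal x) A' (A⊆N x∈A) A'⊆↓x }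
    ub : ∀ A' → A' ∈ ∇ D A → A' ⊑ A
    ub A' (x , x∈A , A'⊆↓x) = principal⊑ A x∈A ∘ A'⊆↓x
    lub : ∀ V → (∀ A' → A' ∈ ∇ D A → A' ⊑ V) → A ⊑ V
    lub V ∇A⊑V x∈A = ∇A⊑V (principal _) (principal◁A x∈A) ≤-refl

module _ {ℓ} (em : ExcludedMiddle (suc ℓ)) (D : Dcpo ℓ) where
  open Dcpo D using (Carrier; _≤_; poset)
  open Poset poset using () renaming (refl to ≤-refl)

  private
    _⊑_ : Irr D → Irr D → Set ℓ
    _⊑_ = _⊑Irr_ D

  -- The intersection of all Scott-closed supersets; resizing brings this
  -- impredicative definition back to the level of subsets of D.
  closure : Pred Carrier (suc ℓ) → Pred Carrier ℓ
  closure P x = Resized em ℓ (∀ C → IsScottClosed D C → P ⊆ C → x ∈ C)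

  closure-scottClosed : ∀ P → IsScottClosed D (closure P)
  closure-scottClosed P = lowerCl , sup∈Cl
    where
    lowerCl : IsLower _≤_ (closure P)
    lowerCl x y x∈cl y≤x = resize em λ C scC@(lowC , _) P⊆C → lowC x y (unresize em x∈cl C scC P⊆C) y≤x
    sup∈Cl : ∀ S u → Directed _≤_ S → S ⊆ closure P → IsSup _≤_ S u → u ∈ closure P
    sup∈Cl S u dirS S⊆cl supS = resize em λ C scC@(_ , sup∈C) P⊆C →
      sup∈C S u dirS (λ x∈S → unresize em (S⊆cl x∈S) C scC P⊆C) supS

  ⊆-closure : ∀ {P} → P ⊆ closure P
  ⊆-closure x∈P = resize em λ _ _ P⊆C → P⊆C x∈P

  closure-least : ∀ {P C} → IsScottClosed D C → P ⊆ C → closure P ⊆ C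
  closure-least {C = C} scC P⊆C x∈cl = unresize em x∈cl C scC P⊆C

  ⋃ : Pred (Irr D) (suc ℓ) → Pred Carrier (suc ℓ)
  ⋃ S x = ∃ λ A → A ∈ S × x ∈ proj₁ A

  closure-⋃-irreducible : ∀ S → Directed _⊑_ S → Irreducible D (closure (⋃ S))
  closure-⋃-irreducible S dirS@((A₀ , A₀∈S) , _) = nonempty (proj₁ (proj₂ (proj₂ A₀))) , split
    where
    nonempty : (∃ λ x → x ∈ proj₁ A₀) → ∃ λ x → x ∈ closure (⋃ S)
    nonempty (x , x∈A₀) = x , ⊆-closure (A₀ , A₀∈S , x∈A₀)
    ⊆-lower : ∀ B → IsLower _⊑_ (λ A → proj₁ A ⊆ B)
    ⊆-lower B A A' A⊆B A'⊆A = A⊆B ∘ A'⊆A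
    split : ∀ B C → IsScottClosed D B → IsScottClosed D C → closure (⋃ S) ⊆ B ∪ C →
            closure (⋃ S) ⊆ B ⊎ closure (⋃ S) ⊆ C
    split B C scB scC cl⊆B∪C with directed-⊆-∪ _⊑_ em dirS (⊆-lower B) (⊆-lower C) each⊆B⊎⊆C
      where
      each⊆B⊎⊆C : S ⊆ (λ A → proj₁ A ⊆ B) ∪ (λ A → proj₁ A ⊆ C)
      each⊆B⊎⊆C {A} A∈S = proj₂ (proj₂ (proj₂ A)) B C scB scC λ x∈A → cl⊆B∪C (⊆-closure (A , A∈S , x∈A))
    ... | inj₁ S⊆B = inj₁ (closure-least scB λ (A , A∈S , x∈A) → S⊆B A∈S x∈A)
    ... | inj₂ S⊆C = inj₂ (closure-least scC λ (A , A∈S , x∈A) → S⊆C A∈S x∈A)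

  -- The supremum of a directed family in Irr(D) lies inside the closure of its union.
  ⊆-scottClosed : ∀ {B} → IsScottClosed D B → ScottClosed _⊑_ (suc ℓ) (λ A → proj₁ A ⊆ B)
  ⊆-scottClosed {B} scB = (λ A A' A⊆B A'⊆A → A⊆B ∘ A'⊆A) , sup⊆B
    where
    sup⊆B : ∀ S U → Directed _⊑_ S → S ⊆ (λ A → proj₁ A ⊆ B) → IsSup _⊑_ S U → proj₁ U ⊆ B
    sup⊆B S U dirS S⊆B (_ , lub) = closure-least scB ⋃S⊆B ∘ lub V S⊑V
      where
      V : Irr D
      V = closure (⋃ S) , closure-scottClosed (⋃ S) , closure-⋃-irreducible S dirS
      S⊑V : ∀ A → A ∈ S → A ⊑ V
      S⊑V A A∈S x∈A = ⊆-closure (A , A∈S , x∈A)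
      ⋃S⊆B : ⋃ S ⊆ B
      ⋃S⊆B (A , A∈S , x∈A) = S⊆B A∈S x∈A

  principal-inaccessible : ∀ x → Inaccessible _⊑_ ℓ (principal D x)
  principal-inaccessible x L scL@(lowL , _) ((A₀ , A₀∈L) , splitL) (_ , lub) =
    lub U L⊑U ≤-refl
    where
    L⊑U : ∀ A → A ∈ L → proj₁ A ⊆ L ∘ principal D
    L⊑U A A∈L y∈A = lowL A (principal D _) A∈L (principal⊑ D A y∈A)
    nonempty : (∃ λ y → y ∈ proj₁ A₀) → ∃ λ y → y ∈ L ∘ principal D
    nonempty (y , y∈A₀) = y , L⊑U A₀ A₀∈L y∈A₀
    split : ∀ B C → IsScottClosed D B → IsScottClosed D C → L ∘ principal D ⊆ B ∪ C →
            L ∘ principal D ⊆ B ⊎ L ∘ principal D ⊆ C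
    split B C scB scC U⊆B∪C
      with splitL (λ A → proj₁ A ⊆ B) (λ A → proj₁ A ⊆ C) (⊆-scottClosed scB) (⊆-scottClosed scC)
                  (λ {A} A∈L → proj₂ (proj₂ (proj₂ A)) B C scB scC (U⊆B∪C ∘ L⊑U A A∈L))
    ... | inj₁ L⊆B = inj₁ λ ↓y∈L → L⊆B ↓y∈L ≤-refl
    ... | inj₂ L⊆C = inj₂ λ ↓y∈L → L⊆C ↓y∈L ≤-refl
    U : Irr D
    U = L ∘ principal D , principal-preimage-scottClosed D scL ,
        nonempty (proj₁ (proj₂ (proj₂ A₀))) , split

module _ {ℓ} (D : Dcpo ℓ) where
  open Dcpo D using (_≤_; poset)

  ⊑Γ-isPreorder : IsPreorder (_≐_ on proj₁) (_⊑Γ_ D)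
  ⊑Γ-isPreorder = On.isPreorder proj₁ ⊆-isPreorder

  Irr⇒Γ : Irr D → Γ D
  Irr⇒Γ (A , scA , _) = A , scA

  Irr⇒Γ-embedding : IsOrderEmbedding (_⊑Irr_ D) (_⊑Γ_ D) Irr⇒Γ
  Irr⇒Γ-embedding = record { mono = λ A⊆B → A⊆B ; reflect = λ A⊆B → A⊆B }

  Γ-∅ : Γ D
  Γ-∅ = (λ _ → Lift ℓ ⊥) , (λ _ _ ()) , λ { _ _ ((_ , x₀∈S) , _) S⊆∅ _ → S⊆∅ x₀∈S }

  Γ-∪ : ExcludedMiddle ℓ → Γ D → Γ D → Γ D
  Γ-∪ em (B , scB) (C , scC) = B ∪ C , ∪-scottClosed _≤_ (Poset.trans poset) em scB scC

module _ {ℓ} (D E : Dcpo ℓ) where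

  OrderIso-Γ : OrderIso (Dcpo._≤_ D) (Dcpo._≤_ E) → OrderIso (_⊑Γ_ D) (_⊑Γ_ E)
  OrderIso-Γ iso@(f , g , _ , _ , fg , gf) = F , G , (λ _ _ A⊆A' → A⊆A') , F-reflect , FG , GF
    where
    F : Γ D → Γ E
    F (A , scA) = A ∘ g , OrderIso-preimage-scottClosed (Poset.isPreorder (Dcpo.poset D))
                            (OrderIso-sym (Poset.isPreorder (Dcpo.poset E)) iso) scA
    G : Γ E → Γ D
    G (B , scB) = B ∘ f , OrderIso-preimage-scottClosed (Poset.isPreorder (Dcpo.poset E)) iso scB
    F-reflect : ∀ A A' → _⊑Γ_ E (F A) (F A') → _⊑Γ_ D A A'
    F-reflect (A , (lowA , _)) (A' , (lowA' , _)) FA⊆FA' {x} x∈A =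
      lowA' (g (f x)) x (FA⊆FA' (lowA x (g (f x)) x∈A (proj₁ (gf x)))) (proj₂ (gf x))
    FG : ∀ B → _⊑Γ_ E (F (G B)) B × _⊑Γ_ E B (F (G B))
    FG (B , (lowB , _)) = (λ {y} y∈ → lowB (f (g y)) y y∈ (proj₂ (fg y)))
                        , (λ {y} y∈B → lowB y (f (g y)) y∈B (proj₁ (fg y)))
    GF : ∀ A → _⊑Γ_ D (G (F A)) A × _⊑Γ_ D A (G (F A))
    GF (A , (lowA , _)) = (λ {x} x∈ → lowA (g (f x)) x x∈ (proj₂ (gf x)))
                        , (λ {x} x∈A → lowA x (g (f x)) x∈A (proj₁ (gf x)))

module _ {ℓ} (em : ExcludedMiddle (suc ℓ)) (D E : Dcpo ℓ) where

  OrderIso-Γ-irreducible : (iso : OrderIso (_⊑Γ_ D) (_⊑Γ_ E)) →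
    ∀ A → Irreducible D (proj₁ A) → Irreducible E (proj₁ (proj₁ iso A))
  OrderIso-Γ-irreducible iso@(f , g , f-mono , f-reflect , fg , gf) A ((x , x∈A) , splitA) =
    nonempty , split
    where
    em₀ : ExcludedMiddle ℓ
    em₀ = em-lower (suc ℓ) em
    g-mono : ∀ B C → _⊑Γ_ E B C → _⊑Γ_ D (g B) (g C)
    g-mono = proj₁ (proj₂ (proj₂ (OrderIso-sym (⊑Γ-isPreorder E) iso)))
    nonempty : ∃ λ y → y ∈ proj₁ (f A)
    nonempty with em₀ {∃ λ y → y ∈ proj₁ (f A)}
    ... | yes fA≠∅ = fA≠∅
    ... | no fA=∅ = ⊥-elim (lower (f-reflect A (Γ-∅ D) (λ {y} y∈fA → ⊥-elim (fA=∅ (y , y∈fA))) x∈A))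
    split : ∀ B C → IsScottClosed E B → IsScottClosed E C → proj₁ (f A) ⊆ B ∪ C →
            proj₁ (f A) ⊆ B ⊎ proj₁ (f A) ⊆ C
    split B C scB scC fA⊆B∪C
      with splitA (proj₁ (g (B , scB))) (proj₁ (g (C , scC))) (proj₂ (g (B , scB))) (proj₂ (g (C , scC)))
                  A⊆gB∪gC
      where
      gB∪gC : Γ D
      gB∪gC = Γ-∪ D em₀ (g (B , scB)) (g (C , scC))
      B∪C : Γ E
      B∪C = Γ-∪ E em₀ (B , scB) (C , scC)
      B∪C⊆fgB∪gC : _⊑Γ_ E B∪C (f gB∪gC)
      B∪C⊆fgB∪gC (inj₁ y∈B) = f-mono (g (B , scB)) gB∪gC inj₁ (proj₂ (fg (B , scB)) y∈B)
      B∪C⊆fgB∪gC (inj₂ y∈C) = f-mono (g (C , scC)) gB∪gC inj₂ (proj₂ (fg (C , scC)) y∈C)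
      A⊆gB∪gC : _⊑Γ_ D A gB∪gC
      A⊆gB∪gC x∈A = proj₁ (gf gB∪gC) (g-mono B∪C (f gB∪gC) B∪C⊆fgB∪gC
                      (g-mono (f A) B∪C fA⊆B∪C (proj₂ (gf A) x∈A)))
    ... | inj₁ A⊆gB = inj₁ (proj₁ (fg (B , scB)) ∘ f-mono A (g (B , scB)) A⊆gB)
    ... | inj₂ A⊆gC = inj₂ (proj₁ (fg (C , scC)) ∘ f-mono A (g (C , scC)) A⊆gC)

  OrderIso-Irr-principal : Dominated E → (iso : OrderIso (_⊑Irr_ D) (_⊑Irr_ E)) →
    ∀ x → ∃ λ y → SymInterior (_⊑Irr_ E) (proj₁ iso (principal D x)) (principal E y)
  OrderIso-Irr-principal dominatedE iso x =
    inaccessible⇒principal E dominatedE (proj₁ iso (principal D x))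
      (OrderIso-inaccessible (⊑Irr-isPreorder D) (⊑Irr-isPreorder E) iso (principal-inaccessible em D x))

module _ {ℓ} (em : ExcludedMiddle (suc ℓ)) (D E : Dcpo ℓ) where

  OrderIso-Γ⇒Irr : OrderIso (_⊑Γ_ D) (_⊑Γ_ E) → OrderIso (_⊑Irr_ D) (_⊑Irr_ E)
  OrderIso-Γ⇒Irr iso =
    OrderIso-restrict (⊑Γ-isPreorder D) (⊑Γ-isPreorder E) (Irr⇒Γ-embedding D) (Irr⇒Γ-embedding E) iso
      (image D E iso) (image E D (OrderIso-sym (⊑Γ-isPreorder E) iso))
    where
    image : ∀ F G (iso : OrderIso (_⊑Γ_ F) (_⊑Γ_ G)) (A : Irr F) →
            ∃ λ B → SymInterior (_⊑Γ_ G) (proj₁ iso (Irr⇒Γ F A)) (Irr⇒Γ G B)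
    image F G iso A@(_ , _ , irrA) =
      (proj₁ fA , proj₂ fA , OrderIso-Γ-irreducible em F G iso (Irr⇒Γ F A) irrA) ,
      (λ y∈ → y∈) , (λ y∈ → y∈)
      where
      fA : Γ G
      fA = proj₁ iso (Irr⇒Γ F A)

  OrderIso-Irr⇒points : Dominated D → Dominated E → OrderIso (_⊑Irr_ D) (_⊑Irr_ E) →
                        OrderIso (Dcpo._≤_ D) (Dcpo._≤_ E)
  OrderIso-Irr⇒points dominatedD dominatedE iso =
    OrderIso-restrict (⊑Irr-isPreorder D) (⊑Irr-isPreorder E) (principal-embedding D) (principal-embedding E) iso
      (OrderIso-Irr-principal em D E dominatedE iso)
      (OrderIso-Irr-principal em E D dominatedD (OrderIso-sym (⊑Irr-isPreorder E) iso))

theorem2p13 : ∀ {ℓ} → ExcludedMiddle (suc ℓ) → (D E : Dcpo ℓ) → Dominated D → Dominated E →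
    ((OrderIso (Dcpo._≤_ D) (Dcpo._≤_ E) → OrderIso (_⊑Γ_ D) (_⊑Γ_ E))
    × (OrderIso (_⊑Γ_ D) (_⊑Γ_ E) → OrderIso (_⊑Irr_ D) (_⊑Irr_ E))
    × (OrderIso (_⊑Irr_ D) (_⊑Irr_ E) → OrderIso (Dcpo._≤_ D) (Dcpo._≤_ E)))
theorem2p13 em D E dominatedD dominatedE =
  OrderIso-Γ D E , OrderIso-Γ⇒Irr em D E , OrderIso-Irr⇒points em D E dominatedD dominatedE
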